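{- Let $Y$ be an invariant set and let $X$ be a finitely supported subset of $Y$ that is not FSM uniformly infinite. (1) If $f:\wp_{us}(X)\to\wp_{us}(X)$ is finitely supported and satisfies $Z\subseteq f(Z)$ for all $Z\in\wp_{us}(X)$, then for each $Z\in\wp_{us}(X)$ there exists $m\in\mathbb N$ such that $f^m(Z)$ is a fixed point of $f$. (2) If $f:\wp_{fin}(X)\to\wp_{fin}(X)$ is finitely supported and satisfies $Z\subseteq f(Z)$ for all $Z\in\wp_{fin}(X)$, then for each $Z\in\wp_{fin}(X)$ there exists $m\in\mathbb N$ such that $f^m(Z)$ is a fixed point of $f$.
   Context: Fix an infinite set $A$ of atoms. $S_A$ is the group of bijections of $A$ that are compositions of finitely many transpositions. An $S_A$-set is a set with a group action $\cdot$ of $S_A$. For $S\subseteq A$, $Fix(S)=\{\pi\in S_A:\pi(a)=a\ \forall a\in S\}$; $S$ supports $x$ if $\pi\cdot x=x$ for all $\pi\in Fix(S)$; the least finite supporting set of $x$ is $supp(x)$. An invariant set is an $S_A$-set all of whose elements have finite supporting sets. Powersets carry $\pi\star Z=\{\pi\cdot z:z\in Z\}$; $\wp_{fs}(Y)$ is the set of subsets of $Y$ finitely supported under $\star$; its elements are the finitely supported subsets of $Y$. Cartesian products carry the componentwise action. A set is uniformly supported if one finite $S\subseteq A$ supports all its elements. For $X\in\wp_{fs}(Y)$: $\wp_{us}(X)$ is the set of uniformly supported subsets of $X$ (including $\emptyset$) and $\wp_{fin}(X)$ the set of finite subsets of $X$; both are subsets of $\wp_{fs}(Y)$ supported by $supp(X)$.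 $X$ is FSM uniformly infinite if it has an infinite uniformly supported subset. A function $f:Z\to T$ between finitely supported subsets of invariant sets $U,V$ is finitely supported if its graph is a finitely supported subset of $U\times V$; equivalently a finite $S$ supports $f$ iff for all $\pi\in Fix(S)$, $x\in Z$: $\pi\cdot x\in Z$, $\pi\cdot f(x)\in T$, $f(\pi\cdot x)=\pi\cdot f(x)$. -}

module Defs where

open import Data.Nat using (ℕ; zero; suc)
open import Data.Product using (Σ; Σ-syntax; ∃; ∃-syntax; _×_; _,_; proj₁; proj₂)
open import Data.List using (List; []; _∷_; _++_)
open import Data.List.Membership.Propositional using (_∈_)
open import Relation.Binary.PropositionalEquality using (_≡_)
open import Relation.Binary.Definitions using (DecidableEquality)
open import Relation.Nullary using (¬_; yes; no)
open import Function.Base using (id; _∘_)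
open import Function.Definitions using (Injective)

InfiniteAtoms : Set → Set
InfiniteAtoms A = Σ (ℕ → A) λ g → Injective _≡_ _≡_ g

iter : ∀ {a} {B : Set a} → (B → B) → ℕ → B → B
iter f zero    x = x
iter f (suc m) x = f (iter f m x)

module FSM (A : Set) (_≟_ : DecidableEquality A) where

  swap : A → A → A → A
  swap a b c with c ≟ a
  ... | yes _ = b
  ... | no _ with c ≟ b
  ...   | yes _ = a
  ...   | no _  = c

  -- Elements of S_A are represented by finite lists of transpositions,
  -- the list (t₁ ∷ … ∷ tₙ) denoting the composition t₁ ∘ … ∘ tₙ.
  Perm : Set
  Perm = List (A × A)

  ⟦_⟧ : Perm → A → A
  ⟦ [] ⟧          = id
  ⟦ (a , b) ∷ π ⟧ = swap a b ∘ ⟦ π ⟧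

  -- An S_A-set: an action of S_A (the action only depends on the bijection
  -- denoted by a list of transpositions, see act-ext).
  record SASet : Set₁ where
    field
      Carrier  : Set
      _·_      : Perm → Carrier → Carrier
      act-id   : ∀ x → [] · x ≡ x
      act-comp : ∀ π σ x → (π ++ σ) · x ≡ π · (σ · x)
      act-ext  : ∀ π σ → (∀ a → ⟦ π ⟧ a ≡ ⟦ σ ⟧ a) → ∀ x → π · x ≡ σ · x

  Fix : List A → Perm → Set
  Fix S π = ∀ a → a ∈ S → ⟦ π ⟧ a ≡ a

  module _ (Y : SASet) where
    open SASet Y

    Supports : List A → Carrier → Set
    Supports S x = ∀ π → Fix S π → π · x ≡ x

    FinitelySupported : Carrier → Set
    FinitelySupported x = ∃[ S ] Supports S x

    Invariant : Set
    Invariant = ∀ x → FinitelySupported x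

    Subset : Set₁
    Subset = Carrier → Set

    _⊆_ : Subset → Subset → Set
    Z ⊆ W = ∀ y → Z y → W y

    _≐_ : Subset → Subset → Set
    Z ≐ W = Z ⊆ W × W ⊆ Z

    _⋆_ : Perm → Subset → Subset
    (π ⋆ Z) y = ∃[ z ] (Z z × π · z ≡ y)

    SupportsSet : List A → Subset → Set
    SupportsSet S Z = ∀ π → Fix S π → (π ⋆ Z) ≐ Z

    FinitelySupportedSet : Subset → Set
    FinitelySupportedSet Z = ∃[ S ] SupportsSet S Z

    UniformlySupported : Subset → Set
    UniformlySupported Z = ∃[ S ] (∀ z → Z z → Supports S z)

    Finite : Subset → Set
    Finite Z = ∃[ l ] (∀ y → (Z y → y ∈ l) × (y ∈ l → Z y))

    Infinite : Subset → Set
    Infinite Z = ¬ Finite Z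

    UniformlyInfinite : Subset → Set₁
    UniformlyInfinite X = ∃[ Z ] (Z ⊆ X × UniformlySupported Z × Infinite Z)

    ℘us : Subset → Subset → Set
    ℘us X Z = Z ⊆ X × UniformlySupported Z

    ℘fin : Subset → Subset → Set
    ℘fin X Z = Z ⊆ X × Finite Z

    -- the set { Z | 𝒫 Z } of subsets (elements compared by ≐)
    Elems : (Subset → Set) → Set₁
    Elems 𝒫 = Σ Subset 𝒫

    -- f is a genuine function on the set of subsets: it respects
    -- equality of subsets (and ignores the membership proofs)
    RespectsEq : {𝒫 : Subset → Set} → (Elems 𝒫 → Elems 𝒫) → Set₁
    RespectsEq f = ∀ W W' → proj₁ W ≐ proj₁ W' → proj₁ (f W) ≐ proj₁ (f W')

    SupportsFun : (𝒫 : Subset → Set) → List A → (Elems 𝒫 → Elems 𝒫) → Set₁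
    SupportsFun 𝒫 S f = ∀ π → Fix S π → ∀ (W : Elems 𝒫) →
      Σ[ p ∈ 𝒫 (π ⋆ proj₁ W) ]
        (𝒫 (π ⋆ proj₁ (f W)) × (proj₁ (f (π ⋆ proj₁ W , p)) ≐ (π ⋆ proj₁ (f W))))

    FinitelySupportedFun : (𝒫 : Subset → Set) → (Elems 𝒫 → Elems 𝒫) → Set₁
    FinitelySupportedFun 𝒫 f = ∃[ S ] SupportsFun 𝒫 S f

    Inflationary : {𝒫 : Subset → Set} → (Elems 𝒫 → Elems 𝒫) → Set₁
    Inflationary f = ∀ W → proj₁ W ⊆ proj₁ (f W)

    IsFixedPoint : {𝒫 : Subset → Set} → (Elems 𝒫 → Elems 𝒫) → Elems 𝒫 → Set
    IsFixedPoint f W = proj₁ (f W) ≐ proj₁ W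

-- Iterate f from Z.  Since f is inflationary the iterates increase, and if none of them
-- were a fixed point each step would add a new element, making their union U infinite.
-- All iterates are supported by one finite list T (the supports of f and Z), and each
-- iterate is finite.  The key fact is that the elements of a FINITE set supported by T
-- are themselves supported by T: such an element x has a finite Fix(T)-orbit, and an
-- atom a ∉ T can be dropped from any support a ∷ R of x, because among the infinitely
-- many images (a c)·x with c fresh two coincide, which forces (a c)·x = x, and then
-- each π ∈ Fix(R) fixes x since its conjugate by (a c) lies in Fix(a ∷ R).  Hence U ⊆ X
-- is uniformly supported and infinite, contradicting that X is not uniformly infinite.
-- Members of ℘us(X) are finite because X is not uniformly infinite, and members of
-- ℘fin(X) are uniformly supported because Y is invariant, so both parts are instances.
module Submission where

open import Defs
open import Level using (0ℓ)
open import Data.Nat using (ℕ; zero; suc; _+_; _<_; s≤s)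
open import Data.Nat.Properties using (n<1+n; <-irrefl; m≤n⇒m<n∨m≡n; m≤n⇒∃[o]m+o≡n; +-comm)
open import Data.Product using (_×_; ∃-syntax; _,_; proj₁; proj₂)
open import Data.List using (List; []; _∷_; _++_; length; lookup; concatMap)
open import Data.List.Membership.Propositional using (_∈_; _∉_)
open import Data.List.Membership.Propositional.Properties using (∈-++⁺ˡ; ∈-++⁺ʳ; ∈-concatMap⁺)
open import Data.List.Relation.Unary.Any using (here; there; index)
open import Data.List.Relation.Unary.Any.Properties using (lookup-index)
import Data.List.Relation.Unary.Any as Any
open import Data.Fin using (toℕ)
open import Data.Fin.Properties using (pigeonhole)
open import Data.Sum using (inj₁; inj₂)
open import Data.Empty using (⊥-elim)
open import Relation.Nullary using (¬_; yes; no)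
open import Relation.Binary.PropositionalEquality
open import Relation.Binary.Definitions using (DecidableEquality)
open import Axiom.ExcludedMiddle using (ExcludedMiddle)

sequence-repeats : {B : Set} (l : List B) (h : ℕ → B) → (∀ n → h n ∈ l) →
                   ∃[ m ] ∃[ n ] (m < n × h m ≡ h n)
sequence-repeats l h h∈l with pigeonhole (n<1+n (length l)) (λ i → index (h∈l (toℕ i)))
... | i , j , i<j , same-index =
  toℕ i , toℕ j , i<j ,
  trans (lookup-index (h∈l (toℕ i)))
        (trans (cong (lookup l) same-index) (sym (lookup-index (h∈l (toℕ j)))))

module Transpositions (A : Set) (_≟_ : DecidableEquality A) where
  open FSM A _≟_

  τ : A → A → Perm
  τ a b = (a , b) ∷ []

  swap-fst : ∀ a b → swap a b a ≡ b
  swap-fst a b with a ≟ a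
  ... | yes _ = refl
  ... | no a≢a = ⊥-elim (a≢a refl)

  swap-snd : ∀ a b → swap a b b ≡ a
  swap-snd a b with b ≟ a
  ... | yes b≡a = b≡a
  ... | no _ with b ≟ b
  ...   | yes _ = refl
  ...   | no b≢b = ⊥-elim (b≢b refl)

  swap-other : ∀ a b c → c ≢ a → c ≢ b → swap a b c ≡ c
  swap-other a b c c≢a c≢b with c ≟ a
  ... | yes c≡a = ⊥-elim (c≢a c≡a)
  ... | no _ with c ≟ b
  ...   | yes c≡b = ⊥-elim (c≢b c≡b)
  ...   | no _ = refl

  data Position₂ (z a b : A) : Set where
    at-a  : z ≡ a → Position₂ z a b
    at-b  : z ≢ a → z ≡ b → Position₂ z a b
    other : z ≢ a → z ≢ b → Position₂ z a b

  position₂ : ∀ z a b → Position₂ z a b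
  position₂ z a b with z ≟ a
  ... | yes z≡a = at-a z≡a
  ... | no z≢a with z ≟ b
  ...   | yes z≡b = at-b z≢a z≡b
  ...   | no z≢b = other z≢a z≢b

  data Position₃ (z a b c : A) : Set where
    at-a  : z ≡ a → Position₃ z a b c
    at-b  : z ≢ a → z ≡ b → Position₃ z a b c
    at-c  : z ≢ a → z ≢ b → z ≡ c → Position₃ z a b c
    other : z ≢ a → z ≢ b → z ≢ c → Position₃ z a b c

  position₃ : ∀ z a b c → Position₃ z a b c
  position₃ z a b c with position₂ z a b
  ... | at-a z≡a = at-a z≡a
  ... | at-b z≢a z≡b = at-b z≢a z≡b
  ... | other z≢a z≢b with z ≟ c
  ...   | yes z≡c = at-c z≢a z≢b z≡c
  ...   | no z≢c = other z≢a z≢b z≢c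

  swap-involutive : ∀ a b z → swap a b (swap a b z) ≡ z
  swap-involutive a b z with position₂ z a b
  ... | at-a refl rewrite swap-fst z b = swap-snd z b
  ... | at-b _ refl rewrite swap-snd a z = swap-fst a z
  ... | other z≢a z≢b rewrite swap-other a b z z≢a z≢b = swap-other a b z z≢a z≢b

  module _ {a c′ c : A} (a≢c′ : a ≢ c′) (a≢c : a ≢ c) (c′≢c : c′ ≢ c) where
    private
      c′≢a : c′ ≢ a
      c′≢a e = a≢c′ (sym e)
      c≢a : c ≢ a
      c≢a e = a≢c (sym e)
      c≢c′ : c ≢ c′
      c≢c′ e = c′≢c (sym e)

    swap-as-conjugate : ∀ z → swap a c z ≡ swap a c′ (swap c′ c (swap a c′ z))
    swap-as-conjugate z with position₃ z a c′ c
    ... | at-a refl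
      rewrite swap-fst z c | swap-fst z c′ | swap-fst c′ c | swap-other z c′ c c≢a c≢c′ = refl
    ... | at-b _ refl
      rewrite swap-other a c z c′≢a c′≢c | swap-snd a z | swap-other z c a a≢c′ a≢c
            | swap-fst a z = refl
    ... | at-c _ _ refl
      rewrite swap-snd a z | swap-other a c′ z c≢a c≢c′ | swap-snd c′ z | swap-snd a c′ = refl
    ... | other z≢a z≢c′ z≢c
      rewrite swap-other a c z z≢a z≢c | swap-other a c′ z z≢a z≢c′
            | swap-other c′ c z z≢c′ z≢c | swap-other a c′ z z≢a z≢c′ = refl

    conjugate-swap : ∀ z → swap a c′ (swap c′ c (swap a c z)) ≡ swap c′ c z
    conjugate-swap z with position₃ z a c′ c
    ... | at-a refl
      rewrite swap-fst z c | swap-snd c′ c | swap-snd z c′ | swap-other c′ c z a≢c′ a≢c = refl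
    ... | at-b _ refl
      rewrite swap-other a c z c′≢a c′≢c | swap-fst z c | swap-other a z c c≢a c≢c′ = refl
    ... | at-c _ _ refl
      rewrite swap-snd a z | swap-other c′ z a a≢c′ a≢c | swap-fst a c′ | swap-snd c′ z = refl
    ... | other z≢a z≢c′ z≢c
      rewrite swap-other a c z z≢a z≢c | swap-other c′ c z z≢c′ z≢c
            | swap-other a c′ z z≢a z≢c′ = refl

  swap-fixes : ∀ {S a b} → a ∉ S → b ∉ S → Fix S (τ a b)
  swap-fixes a∉S b∉S z z∈S =
    swap-other _ _ z (λ z≡a → a∉S (subst (_∈ _) z≡a z∈S)) (λ z≡b → b∉S (subst (_∈ _) z≡b z∈S))

  ⟦++⟧ : ∀ π σ z → ⟦ π ++ σ ⟧ z ≡ ⟦ π ⟧ (⟦ σ ⟧ z)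
  ⟦++⟧ [] σ z = refl
  ⟦++⟧ ((a , b) ∷ π) σ z = cong (swap a b) (⟦++⟧ π σ z)

  atoms : Perm → List A
  atoms [] = []
  atoms ((a , b) ∷ π) = a ∷ b ∷ atoms π

  ⟦⟧-fresh : ∀ π c → c ∉ atoms π → ⟦ π ⟧ c ≡ c
  ⟦⟧-fresh [] c _ = refl
  ⟦⟧-fresh ((a , b) ∷ π) c c∉π =
    trans (cong (swap a b) (⟦⟧-fresh π c (λ m → c∉π (there (there m)))))
          (swap-other a b c (λ c≡a → c∉π (here c≡a)) (λ c≡b → c∉π (there (here c≡b))))

module FreshAtoms (em : ExcludedMiddle 0ℓ) (A : Set) (_≟_ : DecidableEquality A)
                  (infinite : InfiniteAtoms A) where
  open import Data.List.Membership.DecPropositional _≟_ using (_∈?_)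

  -- if every atom occurred in l, the injective sequence of atoms would repeat
  fresh-atom : ∀ (l : List A) → ∃[ c ] c ∉ l
  fresh-atom l with em {∃[ c ] c ∉ l}
  ... | yes fresh = fresh
  ... | no no-fresh with sequence-repeats l g all-in-l
    where
    g = proj₁ infinite
    all-in-l : ∀ n → g n ∈ l
    all-in-l n with g n ∈? l
    ... | yes g∈l = g∈l
    ... | no g∉l = ⊥-elim (no-fresh (g n , g∉l))
  ...   | m , n , m<n , gm≡gn = ⊥-elim (<-irrefl (proj₂ infinite gm≡gn) m<n)

  -- An injective sequence of atoms avoiding B: each term is fresh for B and its
  -- predecessors.
  module FreshSequence (B : List A) where
    next : List A → A
    next previous = proj₁ (fresh-atom (B ++ previous))

    previous : ℕ → List A
    previous zero = []
    previous (suc n) = next (previous n) ∷ previous n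

    fresh : ℕ → A
    fresh n = next (previous n)

    fresh∉B : ∀ n → fresh n ∉ B
    fresh∉B n m = proj₂ (fresh-atom (B ++ previous n)) (∈-++⁺ˡ m)

    fresh∈previous : ∀ m n → m < n → fresh m ∈ previous n
    fresh∈previous m (suc n) (s≤s m≤n) with m≤n⇒m<n∨m≡n m≤n
    ... | inj₁ m<n = there (fresh∈previous m n m<n)
    ... | inj₂ refl = here refl

    fresh-injective : ∀ {m n} → m < n → fresh m ≢ fresh n
    fresh-injective {m} {n} m<n fm≡fn =
      proj₂ (fresh-atom (B ++ previous n))
            (∈-++⁺ʳ B (subst (_∈ previous n) fm≡fn (fresh∈previous m n m<n)))

module Stabilisation (em : ExcludedMiddle 0ℓ) (A : Set) (_≟_ : DecidableEquality A)
                     (infinite : InfiniteAtoms A) where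
  open FSM A _≟_
  open import Data.List.Membership.DecPropositional _≟_ using (_∈?_)
  open Transpositions A _≟_
  open FreshAtoms em A _≟_ infinite

  module _ (Y : SASet) where
    open SASet Y

    act-three : ∀ s t u x → (s ∷ t ∷ u ∷ []) · x ≡ (s ∷ []) · ((t ∷ []) · ((u ∷ []) · x))
    act-three s t u x = trans (act-comp (s ∷ []) (t ∷ u ∷ []) x)
                              (cong ((s ∷ []) ·_) (act-comp (t ∷ []) (u ∷ []) x))

    swap-twice : ∀ a b x → τ a b · (τ a b · x) ≡ x
    swap-twice a b x = begin
      τ a b · (τ a b · x)            ≡⟨ sym (act-comp (τ a b) (τ a b) x) ⟩
      ((a , b) ∷ (a , b) ∷ []) · x   ≡⟨ act-ext _ [] (swap-involutive a b) x ⟩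
      [] · x                         ≡⟨ act-id x ⟩
      x                              ∎
      where open ≡-Reasoning

    FiniteOrbit : List A → Carrier → Set
    FiniteOrbit T x = ∃[ l ] (∀ π → Fix T π → π · x ∈ l)

    -- enlarging T shrinks Fix(T), so finite orbits stay finite
    finite-orbit-mono : ∀ {T R x} → (∀ t → t ∈ T → t ∈ R) → FiniteOrbit T x → FiniteOrbit R x
    finite-orbit-mono T⊆R (l , orbit⊆l) = l , λ π fix → orbit⊆l π (λ t t∈T → fix t (T⊆R t t∈T))

    collision-fixes : ∀ {S x a c′ c} → Supports Y S x → c′ ∉ S → c ∉ S →
                      a ≢ c′ → a ≢ c → c′ ≢ c → τ a c′ · x ≡ τ a c · x → τ a c · x ≡ x
    collision-fixes {S} {x} {a} {c′} {c} supp c′∉S c∉S a≢c′ a≢c c′≢c collision = begin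
      τ a c · x
        ≡⟨ act-ext _ ((a , c′) ∷ (c′ , c) ∷ (a , c′) ∷ []) (swap-as-conjugate a≢c′ a≢c c′≢c) x ⟩
      ((a , c′) ∷ (c′ , c) ∷ (a , c′) ∷ []) · x
        ≡⟨ act-three _ _ _ x ⟩
      τ a c′ · (τ c′ c · (τ a c′ · x))
        ≡⟨ cong (λ y → τ a c′ · (τ c′ c · y)) collision ⟩
      τ a c′ · (τ c′ c · (τ a c · x))
        ≡⟨ sym (act-three _ _ _ x) ⟩
      ((a , c′) ∷ (c′ , c) ∷ (a , c) ∷ []) · x
        ≡⟨ act-ext _ (τ c′ c) (conjugate-swap a≢c′ a≢c c′≢c) x ⟩
      τ c′ c · x
        ≡⟨ supp _ (swap-fixes c′∉S c∉S) ⟩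
      x ∎
      where open ≡-Reasoning

    -- If a ∷ R supports x and (a c) fixes x for an atom c fresh for R and π ∈ Fix(R),
    -- then π fixes x: the conjugate (a c) π (a c) lies in Fix(a ∷ R).
    conjugate-fixes : ∀ {R x a c} π → Supports Y (a ∷ R) x → a ∉ R → c ∉ R → c ∉ atoms π →
                      Fix R π → τ a c · x ≡ x → π · x ≡ x
    conjugate-fixes {R} {x} {a} {c} π supp a∉R c∉R c∉π fixπ ac-fixes = begin
      π · x                         ≡⟨ sym (swap-twice a c (π · x)) ⟩
      τ a c · (τ a c · (π · x))     ≡⟨ cong (τ a c ·_) conjugate-fixes-x ⟩
      τ a c · x                     ≡⟨ ac-fixes ⟩
      x                             ∎
      where
      open ≡-Reasoning
      ρ : Perm
      ρ = τ a c ++ (π ++ τ a c)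

      -- ⟦ ρ ⟧ sends a ↦ c ↦ c ↦ a, and fixes each z ∈ R (which differs from a and c)
      ρ-fixes : Fix (a ∷ R) ρ
      ρ-fixes z (here refl) = begin
        swap z c (⟦ π ++ τ z c ⟧ z)   ≡⟨ cong (swap z c) (⟦++⟧ π (τ z c) z) ⟩
        swap z c (⟦ π ⟧ (swap z c z)) ≡⟨ cong (λ w → swap z c (⟦ π ⟧ w)) (swap-fst z c) ⟩
        swap z c (⟦ π ⟧ c)            ≡⟨ cong (swap z c) (⟦⟧-fresh π c c∉π) ⟩
        swap z c c                    ≡⟨ swap-snd z c ⟩
        z                             ∎
      ρ-fixes z (there z∈R) = begin
        swap a c (⟦ π ++ τ a c ⟧ z)   ≡⟨ cong (swap a c) (⟦++⟧ π (τ a c) z) ⟩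
        swap a c (⟦ π ⟧ (swap a c z)) ≡⟨ cong (λ w → swap a c (⟦ π ⟧ w)) (swap-other a c z z≢a z≢c) ⟩
        swap a c (⟦ π ⟧ z)            ≡⟨ cong (swap a c) (fixπ z z∈R) ⟩
        swap a c z                    ≡⟨ swap-other a c z z≢a z≢c ⟩
        z                             ∎
        where
        z≢a : z ≢ a
        z≢a z≡a = a∉R (subst (_∈ R) z≡a z∈R)
        z≢c : z ≢ c
        z≢c z≡c = c∉R (subst (_∈ R) z≡c z∈R)

      conjugate-fixes-x : τ a c · (π · x) ≡ x
      conjugate-fixes-x = begin
        τ a c · (π · x)               ≡⟨ cong (λ y → τ a c · (π · y)) (sym ac-fixes) ⟩
        τ a c · (π · (τ a c · x))     ≡⟨ cong (τ a c ·_) (sym (act-comp π (τ a c) x)) ⟩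
        τ a c · ((π ++ τ a c) · x)    ≡⟨ sym (act-comp (τ a c) (π ++ τ a c) x) ⟩
        ρ · x                         ≡⟨ supp ρ ρ-fixes ⟩
        x                             ∎

    -- When
    -- a ∉ R, the images (a c)·x for an injective sequence of fresh atoms c lie in the
    -- finite orbit, so two of them coincide.
    drop-atom : ∀ {R x} a → FiniteOrbit R x → Supports Y (a ∷ R) x → Supports Y R x
    drop-atom {R} {x} a (l , orbit⊆l) supp π fixπ with a ∈? R
    ... | yes a∈R = supp π λ { z (here refl) → fixπ z a∈R ; z (there z∈R) → fixπ z z∈R }
    ... | no a∉R = fixed-by-collision
                     (sequence-repeats l (λ n → τ a (fresh n) · x)
                                         (λ n → orbit⊆l _ (swap-fixes a∉R (fresh∉R n))))
      where
      open FreshSequence ((a ∷ R) ++ atoms π)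
      fresh∉aR : ∀ n → fresh n ∉ a ∷ R
      fresh∉aR n m = fresh∉B n (∈-++⁺ˡ m)
      fresh∉R : ∀ n → fresh n ∉ R
      fresh∉R n m = fresh∉aR n (there m)
      a≢fresh : ∀ n → a ≢ fresh n
      a≢fresh n a≡c = fresh∉aR n (here (sym a≡c))

      fixed-by-collision : ∃[ i ] ∃[ j ] (i < j × τ a (fresh i) · x ≡ τ a (fresh j) · x) →
                           π · x ≡ x
      fixed-by-collision (i , j , i<j , collision) =
        conjugate-fixes π supp a∉R (fresh∉R j) (λ m → fresh∉B j (∈-++⁺ʳ (a ∷ R) m)) fixπ
          (collision-fixes supp (fresh∉aR i) (fresh∉aR j) (a≢fresh i) (a≢fresh j)
                           (fresh-injective i<j) collision)

    -- Finite-orbit lemma: in an invariant set, an element with finite Fix(T)-orbit is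
    -- supported by T (drop the atoms of any finite support one by one).
    finite-orbit-supported : Invariant Y → ∀ {T x} → FiniteOrbit T x → Supports Y T x
    finite-orbit-supported inv {T} {x} orbit =
      drop-all (proj₁ (inv x)) λ π fix → proj₂ (inv x) π (λ a m → fix a (∈-++⁺ˡ m))
      where
      drop-all : ∀ S → Supports Y (S ++ T) x → Supports Y T x
      drop-all [] supp = supp
      drop-all (a ∷ S) supp =
        drop-all S (drop-atom a (finite-orbit-mono (λ t → ∈-++⁺ʳ S) orbit) supp)

    members-supported : Invariant Y → ∀ {T K} → SupportsSet Y T K → Finite Y K →
                        ∀ x → K x → Supports Y T x
    members-supported inv {T} {K} K-supp (l , K↔l) x x∈K =
      finite-orbit-supported inv (l , λ π fix → proj₁ (K↔l _) (proj₁ (K-supp π fix) _ (x , x∈K , refl)))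

    uniformly-supported⇒fs : ∀ W → UniformlySupported Y W → FinitelySupportedSet Y W
    uniformly-supported⇒fs W (S , W-supp) = S , λ π fix →
      (λ { y (z , z∈W , πz≡y) → subst W (trans (sym (W-supp z z∈W π fix)) πz≡y) z∈W }) ,
      (λ y y∈W → y , y∈W , W-supp y y∈W π fix)

    finite⇒uniformly-supported : Invariant Y → ∀ W → Finite Y W → UniformlySupported Y W
    finite⇒uniformly-supported inv W (l , W↔l) = concatMap support l , λ y y∈W π fix →
      proj₂ (inv y) π (λ a a∈supp-y → fix a (∈-concatMap⁺ support
        (Any.map (λ y≡z → subst (λ w → a ∈ support w) y≡z a∈supp-y) (proj₁ (W↔l y) y∈W))))
      where
      support : Carrier → List A
      support y = proj₁ (inv y)

    ≐-trans : {U V W : Subset Y} → _≐_ Y U V → _≐_ Y V W → _≐_ Y U W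
    ≐-trans (U⊆V , V⊆U) (V⊆W , W⊆V) = (λ y u → V⊆W y (U⊆V y u)) , (λ y w → V⊆U y (W⊆V y w))

    module Iterates {𝒫 : Subset Y → Set} (f : Elems Y 𝒫 → Elems Y 𝒫) (Z : Elems Y 𝒫) where
      W : ℕ → Subset Y
      W n = proj₁ (iter f n Z)

      Union : Subset Y
      Union y = ∃[ n ] W n y

      iterates-increase : Inflationary Y f → ∀ k d → _⊆_ Y (W k) (W (d + k))
      iterates-increase infl k zero y y∈W = y∈W
      iterates-increase infl k (suc d) y y∈W =
        infl (iter f (d + k) Z) y (iterates-increase infl k d y y∈W)

      iterates-supported : RespectsEq Y f → ∀ {Sf SZ} → SupportsFun Y 𝒫 Sf f →
                           SupportsSet Y SZ (proj₁ Z) → ∀ n → SupportsSet Y (Sf ++ SZ) (W n)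
      iterates-supported resp {Sf} f-supp Z-supp zero π fix = Z-supp π (λ z m → fix z (∈-++⁺ʳ Sf m))
      iterates-supported resp {Sf} f-supp Z-supp (suc n) π fix
        with f-supp π (λ z m → fix z (∈-++⁺ˡ m)) (iter f n Z)
      ... | π⋆Wn∈𝒫 , _ , f[π⋆Wn]≐π⋆f[Wn] =
        ≐-trans (proj₂ f[π⋆Wn]≐π⋆f[Wn] , proj₁ f[π⋆Wn]≐π⋆f[Wn])
                (resp (_ , π⋆Wn∈𝒫) (iter f n Z) (iterates-supported resp f-supp Z-supp n π fix))

      new-element : Inflationary Y f → ∀ V → ¬ IsFixedPoint Y f V →
                    ∃[ y ] (proj₁ (f V) y × ¬ proj₁ V y)
      new-element infl V not-fixed with em {∃[ y ] (proj₁ (f V) y × ¬ proj₁ V y)}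
      ... | yes new = new
      ... | no no-new = ⊥-elim (not-fixed (fV⊆V , infl V))
        where
        fV⊆V : _⊆_ Y (proj₁ (f V)) (proj₁ V)
        fV⊆V y y∈fV with em {proj₁ V y}
        ... | yes y∈V = y∈V
        ... | no y∉V = ⊥-elim (no-new (y , y∈fV , y∉V))

      -- if no iterate is a fixed point, every step adds a new element, so the union
      -- is infinite
      union-infinite : Inflationary Y f → ¬ (∃[ m ] IsFixedPoint Y f (iter f m Z)) →
                       Infinite Y Union
      union-infinite infl no-fixed (l , Union↔l) =
        new-elements-distinct
          (sequence-repeats l new (λ n → proj₁ (Union↔l (new n)) (suc n , new∈next n)))
        where
        step : ∀ n → ∃[ y ] (W (suc n) y × ¬ W n y)
        step n = new-element infl (iter f n Z) (λ fixed → no-fixed (n , fixed))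
        new : ℕ → Carrier
        new n = proj₁ (step n)
        new∈next : ∀ n → W (suc n) (new n)
        new∈next n = proj₁ (proj₂ (step n))

        -- new i ∈ W (suc i) ⊆ W j for i < j, while new j ∉ W j
        new-elements-distinct : ¬ (∃[ i ] ∃[ j ] (i < j × new i ≡ new j))
        new-elements-distinct (i , j , i<j , new-i≡new-j) with m≤n⇒∃[o]m+o≡n i<j
        ... | d , suc-i+d≡j = proj₂ (proj₂ (step j))
          (subst (λ k → W k (new j)) (trans (+-comm d (suc i)) suc-i+d≡j)
            (subst (W (d + suc i)) new-i≡new-j (iterates-increase infl (suc i) d _ (new∈next i))))

    stabilises : Invariant Y → (X : Subset Y) → ¬ UniformlyInfinite Y X →
      (𝒫 : Subset Y → Set) → (∀ V → 𝒫 V → _⊆_ Y V X) → (∀ V → 𝒫 V → Finite Y V) →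
      (∀ V → 𝒫 V → FinitelySupportedSet Y V) →
      (f : Elems Y 𝒫 → Elems Y 𝒫) → RespectsEq Y f → FinitelySupportedFun Y 𝒫 f →
      Inflationary Y f → ∀ Z → ∃[ m ] IsFixedPoint Y f (iter f m Z)
    stabilises inv X not-UI 𝒫 ⊆X finite fs f resp (Sf , f-supp) infl Z
      with em {∃[ m ] IsFixedPoint Y f (iter f m Z)}
    ... | yes fixed = fixed
    ... | no no-fixed = ⊥-elim (not-UI (Union , Union⊆X , Union-us , union-infinite infl no-fixed))
      where
      open Iterates f Z
      Union⊆X : _⊆_ Y Union X
      Union⊆X y (n , y∈Wn) = ⊆X _ (proj₂ (iter f n Z)) y y∈Wn
      Union-us : UniformlySupported Y Union
      Union-us = Sf ++ proj₁ (fs _ (proj₂ Z)) , λ y (n , y∈Wn) →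
        members-supported inv (iterates-supported resp f-supp (proj₂ (fs _ (proj₂ Z))) n)
                          (finite _ (proj₂ (iter f n Z))) y y∈Wn

theorem3p5 : ExcludedMiddle 0ℓ →
    (A : Set) (_≟_ : DecidableEquality A) → InfiniteAtoms A →
    let open FSM A _≟_ in
    (Y : SASet) → Invariant Y →
    (X : Subset Y) → FinitelySupportedSet Y X → ¬ UniformlyInfinite Y X →
    ((f : Elems Y (℘us Y X) → Elems Y (℘us Y X)) →
       RespectsEq Y f → FinitelySupportedFun Y (℘us Y X) f → Inflationary Y f →
       ∀ Z → ∃[ m ] IsFixedPoint Y f (iter f m Z))
    ×
    ((f : Elems Y (℘fin Y X) → Elems Y (℘fin Y X)) →
       RespectsEq Y f → FinitelySupportedFun Y (℘fin Y X) f → Inflationary Y f →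
       ∀ Z → ∃[ m ] IsFixedPoint Y f (iter f m Z))
theorem3p5 em A _≟_ infinite Y inv X _ not-UI =
  stabilises Y inv X not-UI (℘us Y X) (λ _ → proj₁) us-finite
             (λ V V∈℘us → uniformly-supported⇒fs Y V (proj₂ V∈℘us)) ,
  stabilises Y inv X not-UI (℘fin Y X) (λ _ → proj₁) (λ _ → proj₂)
             (λ V V∈℘fin → uniformly-supported⇒fs Y V
                             (finite⇒uniformly-supported Y inv V (proj₂ V∈℘fin)))
  where
  open FSM A _≟_
  open Stabilisation em A _≟_ infinite
  us-finite : ∀ V → ℘us Y X V → Finite Y V
  us-finite V (V⊆X , V-us) with em {Finite Y V}
  ... | yes finite = finite
  ... | no infinite = ⊥-elim (not-UI (V , V⊆X , V-us , infinite))
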